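{- For generic $k,q$ (nonzero, no denominators vanishing), the pair defined by $\bm\alpha_0=\bm\beta_0=1$ and, for $n\ge1$, \[ \bm\alpha_n=(-1)^nq^{n^2/2}\left(q^{ -3n/2}+q^{3n/2}\right),\qquad \bm\beta_n=\frac{(-1)^n(1-q^n+kq^{2n})(k;q)_nk^{n-1}q^{(n^2-3n)/2}}{(q;q)_n}, \] is a WP-Bailey pair relative to $a=1$ and $k$.
   Context: For $n\ge0$, $(x;q)_n=\prod_{i=0}^{n-1}(1-xq^i)$. A pair of sequences $(\bm\alpha_n,\bm\beta_n)_{n\ge0}$ is a WP-Bailey pair relative to $a,k$ (base $q$) if $\bm\alpha_0=1$ and for all $n\ge0$, $\bm\beta_n=\sum_{j=0}^{n}\frac{(k/a;q)_{n-j}(k;q)_{n+j}}{(q;q)_{n-j}(aq;q)_{n+j}}\bm\alpha_j$. -}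

module Defs where

open import Level using (Level; _⊔_) renaming (suc to lsuc)
open import Data.Nat using (ℕ; zero; suc) renaming (_+_ to _+ℕ_; _*_ to _*ℕ_; _∸_ to _∸ℕ_)
open import Data.Nat.DivMod using (_/_)
open import Relation.Nullary using (¬_)
open import Algebra.Bundles using (CommutativeRing)
open import Data.Product using (_×_)

-- The value of _⁻¹ at 0#
-- is unspecified (it is never used when denominators are nonzero).
record Field (c ℓ : Level) : Set (lsuc (c ⊔ ℓ)) where
  field
    commutativeRing : CommutativeRing c ℓ
  open CommutativeRing commutativeRing public
  field
    _⁻¹      : Carrier → Carrier
    ⁻¹-inv   : ∀ x → ¬ (x ≈ 0#) → (x * (x ⁻¹)) ≈ 1#
    1≉0      : ¬ (1# ≈ 0#)

module FieldOps {c ℓ : Level} (F : Field c ℓ) where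
  open Field F

  infixr 8 _^_
  infixl 7 _÷_

  _÷_ : Carrier → Carrier → Carrier
  x ÷ y = x * (y ⁻¹)

  _^_ : Carrier → ℕ → Carrier
  x ^ zero  = 1#
  x ^ suc n = x * (x ^ n)

  qPoch : Carrier → Carrier → ℕ → Carrier
  qPoch x q zero    = 1#
  qPoch x q (suc n) = qPoch x q n * (1# - x * (q ^ n))

  sumTo : ℕ → (ℕ → Carrier) → Carrier
  sumTo zero    f = f 0
  sumTo (suc n) f = sumTo n f + f (suc n)

  IsWPBaileyPair : (q a k : Carrier) → (α β : ℕ → Carrier) → Set ℓ
  IsWPBaileyPair q a k α β =
    (α 0 ≈ 1#) × (∀ n → β n ≈ sumTo n (λ j →
        ((qPoch (k ÷ a) q (n ∸ℕ j) * qPoch k q (n +ℕ j))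
          ÷ (qPoch q q (n ∸ℕ j) * qPoch (a * q) q (n +ℕ j))) * α j))

  -- the integer (n² + 3n)/2 = n(n+3)/2 (always a natural number)
  halfPlus : ℕ → ℕ
  halfPlus n = (n *ℕ (n +ℕ 3)) / 2

  -- q^{(n² - 3n)/2}, written as q^{(n²+3n)/2} · (q⁻¹)^{3n}
  qHalfMinus : Carrier → ℕ → Carrier
  qHalfMinus q n = (q ^ halfPlus n) * ((q ⁻¹) ^ (3 *ℕ n))

  -- α_0 = 1, α_n = (-1)^n q^{n²/2} (q^{-3n/2} + q^{3n/2})
  --             = (-1)^n (q^{(n²-3n)/2} + q^{(n²+3n)/2})   (n ≥ 1)
  alpha16 : (q : Carrier) → ℕ → Carrier
  alpha16 q zero    = 1#
  alpha16 q (suc m) =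
    ((- 1#) ^ suc m) * (qHalfMinus q (suc m) + q ^ halfPlus (suc m))

  beta16 : (k q : Carrier) → ℕ → Carrier
  beta16 k q zero    = 1#
  beta16 k q (suc m) =
    ((((((- 1#) ^ suc m) * ((1# - q ^ suc m) + k * (q ^ (2 *ℕ suc m))))
        * qPoch k q (suc m)) * (k ^ m)) * qHalfMinus q (suc m))
      ÷ qPoch q q (suc m)

-- Put ratio a = (k;q)_a/(q;q)_a, so that the WP-Bailey coefficient for a = 1 is
-- W n j = ratio (n-j) ratio (n+j). The auxiliary pair
--   φ_0 = 1,  φ_j = (-1)^j q^(j(j-1)/2) (1 + q^j),   ψ_n = (-1)^n k^n q^(n(n-1)/2) ratio n
-- is itself a WP-Bailey pair: B_n = Σ_j W n j φ_j obeys ψ's first-order recurrence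
-- (1 - q^(n+1)) B_(n+1) + k q^n (1 - k q^n) B_n = 0, because the combined summands telescope
-- against an explicit certificate G. A second certificate E gives
-- k q^n Σ_j W n j α_j = (1 - q^n + k q^(2n)) B_n. Finally k q^n β_n = (1 - q^n + k q^(2n)) ψ_n;
-- multiplying by q^n is what removes the negative powers of q from α and β.

module Submission where

open import Algebra.Bundles using (CommutativeRing; RawRing)
open import Algebra.Solver.Ring.AlmostCommutativeRing
  using (fromCommutativeRing; _-Raw-AlmostCommutative⟶_)
open import Data.Maybe using (Maybe; map)
open import Data.Nat as ℕ using (ℕ; zero; suc; _∸_)
open import Data.Nat.Properties as ℕ using ()
open import Data.Nat.DivMod using (_/_; m*n/n≡m)
open import Data.Nat.Tactic.RingSolver using (solve-∀)
open import Data.Product using (_,_) renaming (_×_ to _×ₚ_)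
open import Data.Product.Properties using (≡-dec)
open import Level using (0ℓ)
open import Relation.Binary.Consequences using (dec⇒weaklyDec)
open import Relation.Binary.PropositionalEquality as ≡ using (_≡_)
open import Relation.Nullary using (¬_)

open import Defs

-- Algebra.Solver.Ring with integer coefficients: the library's ready-made instances need
-- natural coefficients (no cancellation of subtraction) or decidable equality on the ring.
module ℤ-CoefficientRingSolver {c ℓ} (R : CommutativeRing c ℓ) where
  open CommutativeRing R
  open import Algebra.Properties.Ring ring using (-‿distribˡ-*; x[y-z]≈xy-xz)
  open import Algebra.Properties.AbelianGroup +-abelianGroup
    using (⁻¹-∙-comm; ⁻¹-anti-homo‿-; ε⁻¹≈ε)
  open import Algebra.Properties.CommutativeSemigroup +-commutativeSemigroup
    using (interchange)
  open import Algebra.Properties.Semiring.Mult.TCOptimised semiring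
    using (_×_; 1+×; ×-homo-+; ×1-homo-*)
  open import Relation.Binary.Reasoning.Setoid setoid

  -- An integer is a formal difference (a , b) of naturals; the ring operations
  -- below keep one component zero, so equality of coefficients is syntactic.
  Diff : Set
  Diff = ℕ ×ₚ ℕ

  normalise : ℕ → ℕ → Diff
  normalise a b = a ∸ b , b ∸ a

  ℤ-rawRing : RawRing 0ℓ 0ℓ
  ℤ-rawRing = record
    { Carrier = Diff
    ; _≈_     = _≡_
    ; _+_     = λ { (a , b) (c , d) → normalise (a ℕ.+ c) (b ℕ.+ d) }
    ; _*_     = λ { (a , b) (c , d) → normalise (a ℕ.* c ℕ.+ b ℕ.* d) (a ℕ.* d ℕ.+ b ℕ.* c) }
    ; -_      = λ { (a , b) → b , a }
    ; 0#      = 0 , 0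
    ; 1#      = 1 , 0
    }

  difference : Diff → Carrier
  difference (a , b) = a × 1# - b × 1#

  -- Defined by cases so that the constants 0 and 1 denote 0# and 1# on the nose.
  ⟦_⟧ : Diff → Carrier
  ⟦ a , zero ⟧  = a × 1#
  ⟦ a , suc b ⟧ = difference (a , suc b)

  [x+y]-[u+v]≈[x-u]+[y-v] : ∀ x y u v → (x + y) - (u + v) ≈ (x - u) + (y - v)
  [x+y]-[u+v]≈[x-u]+[y-v] x y u v = begin
    (x + y) - (u + v)    ≈⟨ +-congˡ (⁻¹-∙-comm u v) ⟨
    (x + y) + (- u - v)  ≈⟨ interchange x y (- u) (- v) ⟩
    (x - u) + (y - v)    ∎

  [x-y]*[u-v]≈[xu+yv]-[xv+yu] : ∀ x y u v → (x - y) * (u - v) ≈ (x * u + y * v) - (x * v + y * u)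
  [x-y]*[u-v]≈[xu+yv]-[xv+yu] x y u v = begin
    (x - y) * (u - v)                   ≈⟨ distribʳ (u - v) x (- y) ⟩
    x * (u - v) + - y * (u - v)         ≈⟨ +-congˡ (-‿distribˡ-* y (u - v)) ⟨
    x * (u - v) + - (y * (u - v))       ≈⟨ +-cong (x[y-z]≈xy-xz x u v) (-‿cong (x[y-z]≈xy-xz y u v)) ⟩
    (x * u - x * v) + - (y * u - y * v) ≈⟨ +-congˡ (⁻¹-anti-homo‿- (y * u) (y * v)) ⟩
    (x * u - x * v) + (y * v - y * u)   ≈⟨ [x+y]-[u+v]≈[x-u]+[y-v] (x * u) (y * v) (x * v) (y * u) ⟨
    (x * u + y * v) - (x * v + y * u)   ∎

  ⟦⟧≈difference : ∀ p → ⟦ p ⟧ ≈ difference p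
  ⟦⟧≈difference (a , zero)  = sym (trans (+-congˡ ε⁻¹≈ε) (+-identityʳ _))
  ⟦⟧≈difference (a , suc b) = refl

  difference-normalise : ∀ a b → difference (normalise a b) ≈ difference (a , b)
  difference-normalise zero    zero    = refl
  difference-normalise zero    (suc b) = refl
  difference-normalise (suc a) zero    = refl
  difference-normalise (suc a) (suc b) = begin
    difference (normalise a b)                 ≈⟨ difference-normalise a b ⟩
    a × 1# - b × 1#                            ≈⟨ +-identityˡ _ ⟨
    0# + (a × 1# - b × 1#)                     ≈⟨ +-congʳ (-‿inverseʳ 1#) ⟨
    (1# - 1#) + (a × 1# - b × 1#)              ≈⟨ [x+y]-[u+v]≈[x-u]+[y-v] 1# (a × 1#) 1# (b × 1#) ⟨
    (1# + a × 1#) - (1# + b × 1#)              ≈⟨ +-cong (1+× a 1#) (-‿cong (1+× b 1#)) ⟨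
    difference (suc a , suc b)                 ∎

  ⟦normalise⟧ : ∀ a b → ⟦ normalise a b ⟧ ≈ a × 1# - b × 1#
  ⟦normalise⟧ a b = trans (⟦⟧≈difference (normalise a b)) (difference-normalise a b)

  homomorphism : ℤ-rawRing -Raw-AlmostCommutative⟶ fromCommutativeRing R
  homomorphism = record
    { ⟦_⟧    = ⟦_⟧
    ; +-homo = λ { (a , b) (c , d) → begin
        ⟦ normalise (a ℕ.+ c) (b ℕ.+ d) ⟧            ≈⟨ ⟦normalise⟧ (a ℕ.+ c) (b ℕ.+ d) ⟩
        (a ℕ.+ c) × 1# - (b ℕ.+ d) × 1#              ≈⟨ +-cong (×-homo-+ 1# a c) (-‿cong (×-homo-+ 1# b d)) ⟩
        (a × 1# + c × 1#) - (b × 1# + d × 1#)        ≈⟨ [x+y]-[u+v]≈[x-u]+[y-v] _ _ _ _ ⟩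
        difference (a , b) + difference (c , d)      ≈⟨ +-cong (⟦⟧≈difference (a , b)) (⟦⟧≈difference (c , d)) ⟨
        ⟦ a , b ⟧ + ⟦ c , d ⟧                        ∎ }
    ; *-homo = λ { (a , b) (c , d) → begin
        ⟦ normalise (a ℕ.* c ℕ.+ b ℕ.* d) (a ℕ.* d ℕ.+ b ℕ.* c) ⟧
          ≈⟨ ⟦normalise⟧ (a ℕ.* c ℕ.+ b ℕ.* d) (a ℕ.* d ℕ.+ b ℕ.* c) ⟩
        (a ℕ.* c ℕ.+ b ℕ.* d) × 1# - (a ℕ.* d ℕ.+ b ℕ.* c) × 1#
          ≈⟨ +-cong (sum-of-products a c b d) (-‿cong (sum-of-products a d b c)) ⟩
        (a × 1# * c × 1# + b × 1# * d × 1#) - (a × 1# * d × 1# + b × 1# * c × 1#)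
          ≈⟨ [x-y]*[u-v]≈[xu+yv]-[xv+yu] _ _ _ _ ⟨
        difference (a , b) * difference (c , d)
          ≈⟨ *-cong (⟦⟧≈difference (a , b)) (⟦⟧≈difference (c , d)) ⟨
        ⟦ a , b ⟧ * ⟦ c , d ⟧ ∎ }
    ; -‿homo = λ { (a , b) → begin
        ⟦ b , a ⟧                ≈⟨ ⟦⟧≈difference (b , a) ⟩
        b × 1# - a × 1#          ≈⟨ ⁻¹-anti-homo‿- (a × 1#) (b × 1#) ⟨
        - difference (a , b)     ≈⟨ -‿cong (⟦⟧≈difference (a , b)) ⟨
        - ⟦ a , b ⟧              ∎ }
    ; 0-homo = refl
    ; 1-homo = refl
    }
    where
    sum-of-products : ∀ a c b d → (a ℕ.* c ℕ.+ b ℕ.* d) × 1# ≈ a × 1# * c × 1# + b × 1# * d × 1#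
    sum-of-products a c b d =
      trans (×-homo-+ 1# (a ℕ.* c) (b ℕ.* d)) (+-cong (×1-homo-* a c) (×1-homo-* b d))

  ⟦⟧-≡-weaklyDecidable : ∀ p p′ → Maybe (⟦ p ⟧ ≈ ⟦ p′ ⟧)
  ⟦⟧-≡-weaklyDecidable p p′ = map (λ { ≡.refl → refl }) (dec⇒weaklyDec (≡-dec ℕ._≟_ ℕ._≟_) p p′)

  open import Algebra.Solver.Ring ℤ-rawRing (fromCommutativeRing R) homomorphism ⟦⟧-≡-weaklyDecidable
    public using (solve; _:=_; Polynomial; con; _:+_; _:*_; _:-_; :-_)

  0' 1' : ∀ {n} → Polynomial n
  0' = con (0 , 0)
  1' = con (1 , 0)

triangle : ℕ → ℕ
triangle zero    = 0
triangle (suc n) = triangle n ℕ.+ n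

n[n+3]≡[triangle+2n]*2 : ∀ n → n ℕ.* (n ℕ.+ 3) ≡ (triangle n ℕ.+ (n ℕ.+ n)) ℕ.* 2
n[n+3]≡[triangle+2n]*2 zero    = ≡.refl
n[n+3]≡[triangle+2n]*2 (suc n) = begin
  suc n ℕ.* (suc n ℕ.+ 3)                             ≡⟨ expand n ⟩
  n ℕ.* (n ℕ.+ 3) ℕ.+ (n ℕ.+ n ℕ.+ 4)                 ≡⟨ ≡.cong (ℕ._+ (n ℕ.+ n ℕ.+ 4)) (n[n+3]≡[triangle+2n]*2 n) ⟩
  (triangle n ℕ.+ (n ℕ.+ n)) ℕ.* 2 ℕ.+ (n ℕ.+ n ℕ.+ 4) ≡⟨ regroup (triangle n) n ⟩
  (triangle n ℕ.+ n ℕ.+ (suc n ℕ.+ suc n)) ℕ.* 2      ∎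
  where
  open ≡.≡-Reasoning
  expand : ∀ n → suc n ℕ.* (suc n ℕ.+ 3) ≡ n ℕ.* (n ℕ.+ 3) ℕ.+ (n ℕ.+ n ℕ.+ 4)
  expand = solve-∀
  regroup : ∀ t n → (t ℕ.+ (n ℕ.+ n)) ℕ.* 2 ℕ.+ (n ℕ.+ n ℕ.+ 4) ≡ (t ℕ.+ n ℕ.+ (suc n ℕ.+ suc n)) ℕ.* 2
  regroup = solve-∀

[n*[n+3]]/2≡triangle+2n : ∀ n → (n ℕ.* (n ℕ.+ 3)) / 2 ≡ triangle n ℕ.+ (n ℕ.+ n)
[n*[n+3]]/2≡triangle+2n n =
  ≡.trans (≡.cong (_/ 2) (n[n+3]≡[triangle+2n]*2 n)) (m*n/n≡m (triangle n ℕ.+ (n ℕ.+ n)) 2)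

module FieldProperties {c ℓ} (F : Field c ℓ) where
  open Field F
  open FieldOps F
  open ℤ-CoefficientRingSolver commutativeRing
  open import Relation.Binary.Reasoning.Setoid setoid

  x*y≉0⇒y≉0 : ∀ {x y} → ¬ x * y ≈ 0# → ¬ y ≈ 0#
  x*y≉0⇒y≉0 {x} xy≉0 y≈0 = xy≉0 (trans (*-congˡ y≈0) (zeroʳ x))

  *-cancelˡ : ∀ {x y z} → ¬ x ≈ 0# → x * y ≈ x * z → y ≈ z
  *-cancelˡ {x} {y} {z} x≉0 xy≈xz = begin
    y                  ≈⟨ cancel y ⟨
    x ⁻¹ * (x * y)     ≈⟨ *-congˡ xy≈xz ⟩
    x ⁻¹ * (x * z)     ≈⟨ cancel z ⟩
    z                  ∎
    where
    cancel : ∀ u → x ⁻¹ * (x * u) ≈ u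
    cancel u = begin
      x ⁻¹ * (x * u)   ≈⟨ solve 3 (λ x x⁻¹ u → x⁻¹ :* (x :* u) := (x :* x⁻¹) :* u) refl x (x ⁻¹) u ⟩
      (x * x ⁻¹) * u   ≈⟨ *-congʳ (⁻¹-inv x x≉0) ⟩
      1# * u           ≈⟨ *-identityˡ u ⟩
      u                ∎

  x≉0∧y≉0⇒x*y≉0 : ∀ {x y} → ¬ x ≈ 0# → ¬ y ≈ 0# → ¬ x * y ≈ 0#
  x≉0∧y≉0⇒x*y≉0 {x} x≉0 y≉0 xy≈0 = y≉0 (*-cancelˡ x≉0 (trans xy≈0 (sym (zeroʳ x))))

  x*y≈1⇒y≈x⁻¹ : ∀ {x y} → ¬ x ≈ 0# → x * y ≈ 1# → y ≈ x ⁻¹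
  x*y≈1⇒y≈x⁻¹ {x} {y} x≉0 xy≈1 = *-cancelˡ x≉0 (trans xy≈1 (sym (⁻¹-inv x x≉0)))

  1⁻¹≈1 : 1# ⁻¹ ≈ 1#
  1⁻¹≈1 = sym (x*y≈1⇒y≈x⁻¹ 1≉0 (*-identityʳ 1#))

  ⁻¹-cong : ∀ {x y} → ¬ x ≈ 0# → x ≈ y → x ⁻¹ ≈ y ⁻¹
  ⁻¹-cong {x} x≉0 x≈y =
    x*y≈1⇒y≈x⁻¹ (λ y≈0 → x≉0 (trans x≈y y≈0)) (trans (*-congʳ (sym x≈y)) (⁻¹-inv x x≉0))

  ⁻¹-distrib-* : ∀ {x y} → ¬ x ≈ 0# → ¬ y ≈ 0# → (x * y) ⁻¹ ≈ x ⁻¹ * y ⁻¹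
  ⁻¹-distrib-* {x} {y} x≉0 y≉0 = sym (x*y≈1⇒y≈x⁻¹ (x≉0∧y≉0⇒x*y≉0 x≉0 y≉0) (begin
    (x * y) * (x ⁻¹ * y ⁻¹)     ≈⟨ solve 4 (λ x y x⁻¹ y⁻¹ → (x :* y) :* (x⁻¹ :* y⁻¹) := (x :* x⁻¹) :* (y :* y⁻¹))
                                         refl x y (x ⁻¹) (y ⁻¹) ⟩
    (x * x ⁻¹) * (y * y ⁻¹)     ≈⟨ *-cong (⁻¹-inv x x≉0) (⁻¹-inv y y≉0) ⟩
    1# * 1#                     ≈⟨ *-identityʳ 1# ⟩
    1#                          ∎))

  ^-homo-* : ∀ x m n → x ^ (m ℕ.+ n) ≈ x ^ m * x ^ n
  ^-homo-* x zero    n = sym (*-identityˡ (x ^ n))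
  ^-homo-* x (suc m) n = trans (*-congˡ (^-homo-* x m n)) (sym (*-assoc x (x ^ m) (x ^ n)))

  x≉0⇒x^n≉0 : ∀ {x} n → ¬ x ≈ 0# → ¬ x ^ n ≈ 0#
  x≉0⇒x^n≉0 zero    x≉0 = 1≉0
  x≉0⇒x^n≉0 (suc n) x≉0 = x≉0∧y≉0⇒x*y≉0 x≉0 (x≉0⇒x^n≉0 n x≉0)

  x^n*x⁻¹^n≈1 : ∀ {x} n → ¬ x ≈ 0# → x ^ n * (x ⁻¹) ^ n ≈ 1#
  x^n*x⁻¹^n≈1     zero    x≉0 = *-identityʳ 1#
  x^n*x⁻¹^n≈1 {x} (suc n) x≉0 = begin
    (x * x ^ n) * (x ⁻¹ * (x ⁻¹) ^ n)   ≈⟨ solve 4 (λ x xⁿ x⁻¹ x⁻ⁿ → (x :* xⁿ) :* (x⁻¹ :* x⁻ⁿ) := (x :* x⁻¹) :* (xⁿ :* x⁻ⁿ))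
                                                 refl x (x ^ n) (x ⁻¹) ((x ⁻¹) ^ n) ⟩
    (x * x ⁻¹) * (x ^ n * (x ⁻¹) ^ n)   ≈⟨ *-cong (⁻¹-inv x x≉0) (x^n*x⁻¹^n≈1 n x≉0) ⟩
    1# * 1#                             ≈⟨ *-identityʳ 1# ⟩
    1#                                  ∎

  sumTo-cong : ∀ n {f g : ℕ → Carrier} → (∀ j → j ℕ.≤ n → f j ≈ g j) → sumTo n f ≈ sumTo n g
  sumTo-cong zero    f≈g = f≈g 0 ℕ.z≤n
  sumTo-cong (suc n) f≈g =
    +-cong (sumTo-cong n (λ j j≤n → f≈g j (ℕ.m≤n⇒m≤1+n j≤n))) (f≈g (suc n) ℕ.≤-refl)

  sumTo-linear : ∀ n a b (f g : ℕ → Carrier) →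
                 sumTo n (λ j → a * f j + b * g j) ≈ a * sumTo n f + b * sumTo n g
  sumTo-linear zero    a b f g = refl
  sumTo-linear (suc n) a b f g = begin
    sumTo n (λ j → a * f j + b * g j) + (a * f (suc n) + b * g (suc n))
      ≈⟨ +-congʳ (sumTo-linear n a b f g) ⟩
    (a * sumTo n f + b * sumTo n g) + (a * f (suc n) + b * g (suc n))
      ≈⟨ solve 6 (λ a b Σf Σg f g → (a :* Σf :+ b :* Σg) :+ (a :* f :+ b :* g) := a :* (Σf :+ f) :+ b :* (Σg :+ g))
               refl a b (sumTo n f) (sumTo n g) (f (suc n)) (g (suc n)) ⟩
    a * sumTo (suc n) f + b * sumTo (suc n) g ∎

  sumTo-telescope : ∀ n (f G : ℕ → Carrier) → G 0 ≈ 0# →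
                    (∀ j → j ℕ.≤ n → f j ≈ G (suc j) - G j) → sumTo n f ≈ G (suc n)
  sumTo-telescope zero    f G G0≈0 f≈ΔG = begin
    f 0              ≈⟨ f≈ΔG 0 ℕ.z≤n ⟩
    G 1 - G 0        ≈⟨ +-congˡ (-‿cong G0≈0) ⟩
    G 1 - 0#         ≈⟨ solve 1 (λ x → x :- 0' := x) refl (G 1) ⟩
    G 1              ∎
  sumTo-telescope (suc n) f G G0≈0 f≈ΔG = begin
    sumTo n f + f (suc n)
      ≈⟨ +-cong (sumTo-telescope n f G G0≈0 (λ j j≤n → f≈ΔG j (ℕ.m≤n⇒m≤1+n j≤n))) (f≈ΔG (suc n) ℕ.≤-refl) ⟩
    G (suc n) + (G (suc (suc n)) - G (suc n))
      ≈⟨ solve 2 (λ x y → x :+ (y :- x) := y) refl (G (suc n)) (G (suc (suc n))) ⟩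
    G (suc (suc n)) ∎

  *-cong-interchange : ∀ {x y u v f g} → x ≈ u * f → y ≈ v * g → x * y ≈ (u * v) * (f * g)
  *-cong-interchange {u = u} {v} {f} {g} x≈uf y≈vg =
    trans (*-cong x≈uf y≈vg) (solve 4 (λ u f v g → (u :* f) :* (v :* g) := (u :* v) :* (f :* g)) refl u f v g)

  1-u*x-cong : ∀ {x y} u → x ≈ y → 1# - u * x ≈ 1# - u * y
  1-u*x-cong u x≈y = +-congˡ (-‿cong (*-congˡ x≈y))

  qPoch-congˡ : ∀ {x y} z n → x ≈ y → qPoch x z n ≈ qPoch y z n
  qPoch-congˡ z zero    x≈y = refl
  qPoch-congˡ z (suc n) x≈y = *-cong (qPoch-congˡ z n x≈y) (+-congˡ (-‿cong (*-congʳ x≈y)))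

[1+j+d]∸j≡1+d : ∀ j d → suc (j ℕ.+ d) ∸ j ≡ suc d
[1+j+d]∸j≡1+d j d = ≡.trans (≡.cong (_∸ j) (≡.sym (ℕ.+-suc j d))) (ℕ.m+n∸m≡n j (suc d))

-- Identities for j ≤ n are proved at n = j + d, where n ∸ j can be computed.
≤-offset-elim : ∀ {p} (P : ℕ → ℕ → Set p) → (∀ j d → P (j ℕ.+ d) j) → ∀ {n j} → j ℕ.≤ n → P n j
≤-offset-elim P P[j+d,j] {n} {j} j≤n = ≡.subst (λ m → P m j) (ℕ.m+[n∸m]≡n j≤n) (P[j+d,j] j (n ∸ j))

module WPBaileyPair16 {c ℓ} (F : Field c ℓ) (k q : Field.Carrier F)
  (q≉0 : ¬ Field._≈_ F q (Field.0# F))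
  (k≉0 : ¬ Field._≈_ F k (Field.0# F))
  (qPoch-q≉0 : ∀ m → ¬ Field._≈_ F (FieldOps.qPoch F q q m) (Field.0# F)) where

  open Field F
  open FieldOps F
  open FieldProperties F
  open ℤ-CoefficientRingSolver commutativeRing
  open import Algebra.Properties.Ring ring using (-‿distribˡ-*)
  open import Algebra.Properties.AbelianGroup +-abelianGroup using (inverseˡ-unique; x∙y⁻¹≈ε⇒x≈y)
  open import Relation.Binary.Reasoning.Setoid setoid

  sgn : ℕ → Carrier
  sgn j = (- 1#) ^ j

  qTri : ℕ → Carrier
  qTri zero    = 1#
  qTri (suc j) = qTri j * q ^ j

  qTri≈q^triangle : ∀ j → qTri j ≈ q ^ triangle j
  qTri≈q^triangle zero    = refl
  qTri≈q^triangle (suc j) = trans (*-congʳ (qTri≈q^triangle j)) (sym (^-homo-* q (triangle j) j))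

  q^halfPlus≈qTri*q^2j : ∀ j → q ^ halfPlus j ≈ qTri j * (q ^ j * q ^ j)
  q^halfPlus≈qTri*q^2j j = begin
    q ^ halfPlus j                    ≡⟨ ≡.cong (q ^_) ([n*[n+3]]/2≡triangle+2n j) ⟩
    q ^ (triangle j ℕ.+ (j ℕ.+ j))    ≈⟨ ^-homo-* q (triangle j) (j ℕ.+ j) ⟩
    q ^ triangle j * q ^ (j ℕ.+ j)    ≈⟨ *-cong (sym (qTri≈q^triangle j)) (^-homo-* q j j) ⟩
    qTri j * (q ^ j * q ^ j)          ∎

  q^j*qHalfMinus≈qTri : ∀ j → q ^ j * qHalfMinus q j ≈ qTri j
  q^j*qHalfMinus≈qTri j = begin
    q ^ j * (q ^ halfPlus j * (q ⁻¹) ^ (3 ℕ.* j))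
      ≈⟨ *-congˡ (*-cong (q^halfPlus≈qTri*q^2j j) q⁻³ʲ≈) ⟩
    y * (qTri j * (y * y) * (y⁻¹ * (y⁻¹ * y⁻¹)))
      ≈⟨ solve 3 (λ y y⁻¹ Q → y :* (Q :* (y :* y) :* (y⁻¹ :* (y⁻¹ :* y⁻¹)))
                              := Q :* ((y :* y⁻¹) :* ((y :* y⁻¹) :* (y :* y⁻¹)))) refl y y⁻¹ (qTri j) ⟩
    qTri j * ((y * y⁻¹) * ((y * y⁻¹) * (y * y⁻¹)))
      ≈⟨ *-congˡ (trans (*-cong y*y⁻¹≈1 (*-cong y*y⁻¹≈1 y*y⁻¹≈1)) (trans (*-identityˡ _) (*-identityˡ _))) ⟩
    qTri j * 1#
      ≈⟨ *-identityʳ _ ⟩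
    qTri j ∎
    where
    y   = q ^ j
    y⁻¹ = (q ⁻¹) ^ j
    y*y⁻¹≈1 : y * y⁻¹ ≈ 1#
    y*y⁻¹≈1 = x^n*x⁻¹^n≈1 j q≉0
    q⁻³ʲ≈ : (q ⁻¹) ^ (3 ℕ.* j) ≈ y⁻¹ * (y⁻¹ * y⁻¹)
    q⁻³ʲ≈ = begin
      (q ⁻¹) ^ (j ℕ.+ (j ℕ.+ (j ℕ.+ 0)))  ≈⟨ ^-homo-* (q ⁻¹) j _ ⟩
      y⁻¹ * (q ⁻¹) ^ (j ℕ.+ (j ℕ.+ 0))    ≈⟨ *-congˡ (^-homo-* (q ⁻¹) j _) ⟩
      y⁻¹ * (y⁻¹ * (q ⁻¹) ^ (j ℕ.+ 0))    ≡⟨ ≡.cong (λ m → y⁻¹ * (y⁻¹ * (q ⁻¹) ^ m)) (ℕ.+-identityʳ j) ⟩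
      y⁻¹ * (y⁻¹ * y⁻¹)                   ∎

  α : ℕ → Carrier
  α = alpha16 q

  q^[j+d]*α≈ : ∀ j d → q ^ (suc j ℕ.+ d) * α (suc j) ≈
               sgn (suc j) * (qTri (suc j) * (q ^ d * (1# + q ^ suc j * (q ^ suc j * q ^ suc j))))
  q^[j+d]*α≈ j d = begin
    q ^ (suc j ℕ.+ d) * (sgn (suc j) * (qHalfMinus q (suc j) + q ^ halfPlus (suc j)))
      ≈⟨ *-congʳ (^-homo-* q (suc j) d) ⟩
    (y * z) * (sgn (suc j) * (qHalfMinus q (suc j) + q ^ halfPlus (suc j)))
      ≈⟨ solve 5 (λ y z s h⁻ h⁺ → (y :* z) :* (s :* (h⁻ :+ h⁺)) := s :* (z :* (y :* h⁻) :+ z :* (y :* h⁺)))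
               refl y z (sgn (suc j)) (qHalfMinus q (suc j)) (q ^ halfPlus (suc j)) ⟩
    sgn (suc j) * (z * (y * qHalfMinus q (suc j)) + z * (y * q ^ halfPlus (suc j)))
      ≈⟨ *-congˡ (+-cong (*-congˡ (q^j*qHalfMinus≈qTri (suc j))) (*-congˡ (*-congˡ (q^halfPlus≈qTri*q^2j (suc j))))) ⟩
    sgn (suc j) * (z * qTri (suc j) + z * (y * (qTri (suc j) * (y * y))))
      ≈⟨ *-congˡ (solve 3 (λ z y Q → z :* Q :+ z :* (y :* (Q :* (y :* y))) := Q :* (z :* (1' :+ y :* (y :* y))))
                        refl z y (qTri (suc j))) ⟩
    sgn (suc j) * (qTri (suc j) * (z * (1# + y * (y * y)))) ∎
    where
    y z : Carrier
    y = q ^ suc j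
    z = q ^ d

  ratio : ℕ → Carrier
  ratio a = qPoch k q a * qPoch q q a ⁻¹

  ratio[0]≈1 : ratio 0 ≈ 1#
  ratio[0]≈1 = trans (*-identityˡ _) 1⁻¹≈1

  -- ratio a and ratio (suc a) are ratio⁺ a times a factor linear in q ^ a; expanding
  -- every coefficient this way turns each telescoping identity into a polynomial one.
  ratio⁺ : ℕ → Carrier
  ratio⁺ a = qPoch k q a * qPoch q q (suc a) ⁻¹

  qPoch-q⁻¹≈ : ∀ a → qPoch q q a ⁻¹ ≈ qPoch q q (suc a) ⁻¹ * (1# - q * q ^ a)
  qPoch-q⁻¹≈ a = sym (x*y≈1⇒y≈x⁻¹ (qPoch-q≉0 a) (begin
    qPoch q q a * (qPoch q q (suc a) ⁻¹ * (1# - q * q ^ a))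
      ≈⟨ solve 3 (λ p p⁺⁻¹ f → p :* (p⁺⁻¹ :* f) := (p :* f) :* p⁺⁻¹)
               refl (qPoch q q a) (qPoch q q (suc a) ⁻¹) (1# - q * q ^ a) ⟩
    qPoch q q (suc a) * qPoch q q (suc a) ⁻¹
      ≈⟨ ⁻¹-inv _ (qPoch-q≉0 (suc a)) ⟩
    1# ∎))

  ratio≈ratio⁺*[1-qx] : ∀ a {x} → q ^ a ≈ x → ratio a ≈ ratio⁺ a * (1# - q * x)
  ratio≈ratio⁺*[1-qx] a {x} q^a≈x = begin
    qPoch k q a * qPoch q q a ⁻¹                           ≈⟨ *-congˡ (qPoch-q⁻¹≈ a) ⟩
    qPoch k q a * (qPoch q q (suc a) ⁻¹ * (1# - q * q ^ a)) ≈⟨ *-assoc _ _ _ ⟨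
    ratio⁺ a * (1# - q * q ^ a)                            ≈⟨ *-congˡ (1-u*x-cong _ q^a≈x) ⟩
    ratio⁺ a * (1# - q * x)                                ∎

  ratio[1+a]≈ratio⁺*[1-kx] : ∀ a {x} → q ^ a ≈ x → ratio (suc a) ≈ ratio⁺ a * (1# - k * x)
  ratio[1+a]≈ratio⁺*[1-kx] a {x} q^a≈x = begin
    (qPoch k q a * (1# - k * q ^ a)) * qPoch q q (suc a) ⁻¹
      ≈⟨ solve 3 (λ p f d → (p :* f) :* d := (p :* d) :* f) refl _ _ _ ⟩
    ratio⁺ a * (1# - k * q ^ a)
      ≈⟨ *-congˡ (1-u*x-cong _ q^a≈x) ⟩
    ratio⁺ a * (1# - k * x) ∎

  ratio-≡ : ∀ {a b} → a ≡ b → ratio a ≈ ratio b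
  ratio-≡ a≡b = reflexive (≡.cong ratio a≡b)

  ratio[j+d∸j]≈ : ∀ j d → ratio ((j ℕ.+ d) ∸ j) ≈ ratio⁺ d * (1# - q * q ^ d)
  ratio[j+d∸j]≈ j d = trans (ratio-≡ (ℕ.m+n∸m≡n j d)) (ratio≈ratio⁺*[1-qx] d refl)

  ratio[1+j+d∸j]≈ : ∀ j d → ratio (suc (j ℕ.+ d) ∸ j) ≈ ratio⁺ d * (1# - k * q ^ d)
  ratio[1+j+d∸j]≈ j d = trans (ratio-≡ ([1+j+d]∸j≡1+d j d)) (ratio[1+a]≈ratio⁺*[1-kx] d refl)

  -- j + n rather than n + j, so that the second index of W n (suc j) is suc (j + n).
  W : ℕ → ℕ → Carrier
  W n j = ratio (n ∸ j) * ratio (j ℕ.+ n)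

  W[0,0]≈1 : W 0 0 ≈ 1#
  W[0,0]≈1 = trans (*-cong ratio[0]≈1 ratio[0]≈1) (*-identityʳ 1#)

  bailey : (ℕ → Carrier) → ℕ → Carrier
  bailey γ n = sumTo n (λ j → W n j * γ j)

  φ : ℕ → Carrier
  φ zero    = 1#
  φ (suc j) = sgn (suc j) * (qTri (suc j) * (1# + q ^ suc j))

  ψ : ℕ → Carrier
  ψ n = sgn n * (k ^ n * (qTri n * ratio n))

  κ : ℕ → Carrier
  κ n = k * q ^ n * (1# - k * q ^ n)

  G : ℕ → ℕ → Carrier
  G n zero    = 0#
  G n (suc j) = ratio (n ∸ j) * ratio (suc (j ℕ.+ n)) * ((1# - k * (q * (q ^ n * q ^ n))) * (sgn j * qTri (suc j)))

  G-telescopes : ∀ j d → let n = j ℕ.+ d in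
    (1# - q ^ suc n) * (W (suc n) j * φ j) + κ n * (W n j * φ j) ≈ G n (suc j) - G n j
  G-telescopes zero n = begin
    (1# - q * x) * (W (suc n) 0 * 1#) + κ n * (W n 0 * 1#)
      ≈⟨ +-cong (*-congˡ (*-congʳ (*-cong-interchange ratio[1+n]≈ ratio[1+n]≈)))
                (*-congˡ (*-congʳ (*-cong-interchange ratio[n]≈ ratio[n]≈))) ⟩
    (1# - q * x) * (p * ((1# - k * x) * (1# - k * x)) * 1#) + κ n * (p * ((1# - q * x) * (1# - q * x)) * 1#)
      ≈⟨ solve 4 (λ p x q k →
           (1' :- q :* x) :* (p :* ((1' :- k :* x) :* (1' :- k :* x)) :* 1')
             :+ k :* x :* (1' :- k :* x) :* (p :* ((1' :- q :* x) :* (1' :- q :* x)) :* 1')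
           := p :* ((1' :- q :* x) :* (1' :- k :* x)) :* ((1' :- k :* (q :* (x :* x))) :* (1' :* (1' :* 1')))
                :- 0')
         refl p x q k ⟩
    p * ((1# - q * x) * (1# - k * x)) * ((1# - k * (q * (x * x))) * (1# * (1# * 1#))) - 0#
      ≈⟨ +-congʳ (*-congʳ (*-cong-interchange ratio[n]≈ ratio[1+n]≈)) ⟨
    G n 1 - G n 0 ∎
    where
    x = q ^ n
    p = ratio⁺ n * ratio⁺ n
    ratio[n]≈ : ratio n ≈ ratio⁺ n * (1# - q * x)
    ratio[n]≈ = ratio≈ratio⁺*[1-qx] n refl
    ratio[1+n]≈ : ratio (suc n) ≈ ratio⁺ n * (1# - k * x)
    ratio[1+n]≈ = ratio[1+a]≈ratio⁺*[1-kx] n refl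
  G-telescopes (suc i) d = begin
    (1# - q * q ^ n) * (W (suc n) (suc i) * φ (suc i)) + κ n * (W n (suc i) * φ (suc i))
      ≈⟨ +-cong (*-cong (1-u*x-cong q q^n≈X) (*-congʳ W[1+n,1+i]≈))
                (*-cong (*-cong (*-congˡ q^n≈X) (1-u*x-cong k q^n≈X)) (*-congʳ W[n,1+i]≈)) ⟩
    (1# - q * X) * (p * ((1# - k * z) * (1# - k * U)) * φ (suc i))
      + k * X * (1# - k * X) * (p * ((1# - q * z) * (1# - q * U)) * φ (suc i))
      ≈⟨ solve 7 (λ p z r q k s Q →
           let X = q :* (r :* z) ; U = q :* (r :* X) ; φ = (:- 1' :* s) :* (Q :* (1' :+ q :* r)) in
           (1' :- q :* X) :* (p :* ((1' :- k :* z) :* (1' :- k :* U)) :* φ)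
             :+ k :* X :* (1' :- k :* X) :* (p :* ((1' :- q :* z) :* (1' :- q :* U)) :* φ)
           := p :* ((1' :- q :* z) :* (1' :- k :* U)) :* ((1' :- k :* (q :* (X :* X))) :* ((:- 1' :* s) :* (Q :* (q :* r))))
                :- p :* ((1' :- k :* z) :* (1' :- q :* U)) :* ((1' :- k :* (q :* (X :* X))) :* (s :* Q)))
         refl p z r q k (sgn i) (qTri (suc i)) ⟩
    p * ((1# - q * z) * (1# - k * U)) * ((1# - k * (q * (X * X))) * (sgn (suc i) * qTri (suc (suc i))))
      - p * ((1# - k * z) * (1# - q * U)) * ((1# - k * (q * (X * X))) * (sgn i * qTri (suc i)))
      ≈⟨ +-cong (*-cong G[2+i]≈ (*-congʳ 1-kq[q^n]²≈)) (-‿cong (*-cong G[1+i]≈ (*-congʳ 1-kq[q^n]²≈))) ⟨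
    G n (suc (suc i)) - G n (suc i) ∎
    where
    n = suc i ℕ.+ d
    b = suc (i ℕ.+ n)
    r = q ^ i
    z = q ^ d
    X = q * (r * z)
    U = q * (r * X)
    p = ratio⁺ d * ratio⁺ b
    q^n≈X : q ^ n ≈ X
    q^n≈X = *-congˡ (^-homo-* q i d)
    1-kq[q^n]²≈ : 1# - k * (q * (q ^ n * q ^ n)) ≈ 1# - k * (q * (X * X))
    1-kq[q^n]²≈ = 1-u*x-cong k (*-congˡ (*-cong q^n≈X q^n≈X))
    ratio[b]≈ : ratio b ≈ ratio⁺ b * (1# - q * U)
    ratio[b]≈ = ratio≈ratio⁺*[1-qx] b (*-congˡ (trans (^-homo-* q i n) (*-congˡ q^n≈X)))
    ratio[1+b]≈ : ratio (suc b) ≈ ratio⁺ b * (1# - k * U)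
    ratio[1+b]≈ = ratio[1+a]≈ratio⁺*[1-kx] b (*-congˡ (trans (^-homo-* q i n) (*-congˡ q^n≈X)))
    W[1+n,1+i]≈ : W (suc n) (suc i) ≈ p * ((1# - k * z) * (1# - k * U))
    W[1+n,1+i]≈ = *-cong-interchange (ratio[1+j+d∸j]≈ i d) (trans (ratio-≡ (≡.cong suc (ℕ.+-suc i n))) ratio[1+b]≈)
    W[n,1+i]≈ : W n (suc i) ≈ p * ((1# - q * z) * (1# - q * U))
    W[n,1+i]≈ = *-cong-interchange (ratio[j+d∸j]≈ i d) ratio[b]≈
    G[2+i]≈ : ratio (n ∸ suc i) * ratio (suc (suc i ℕ.+ n)) ≈ p * ((1# - q * z) * (1# - k * U))
    G[2+i]≈ = *-cong-interchange (ratio[j+d∸j]≈ i d) ratio[1+b]≈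
    G[1+i]≈ : ratio (n ∸ i) * ratio (suc (i ℕ.+ n)) ≈ p * ((1# - k * z) * (1# - q * U))
    G[1+i]≈ = *-cong-interchange (ratio[1+j+d∸j]≈ i d) ratio[b]≈

  G-boundary : ∀ n → G n (suc n) + (1# - q ^ suc n) * (W (suc n) (suc n) * φ (suc n)) ≈ 0#
  G-boundary n = begin
    ratio (n ∸ n) * ratio (suc (n ℕ.+ n)) * ((1# - k * (q * (x * x))) * (sgn n * qTri (suc n)))
      + (1# - q * x) * (ratio (n ∸ n) * ratio (suc (n ℕ.+ suc n)) * φ (suc n))
      ≈⟨ +-cong (*-congʳ (*-cong-interchange ratio[0]≈ ratio[b]≈))
                (*-congˡ (*-congʳ (*-cong-interchange ratio[0]≈ (trans (ratio-≡ (≡.cong suc (ℕ.+-suc n n))) ratio[1+b]≈)))) ⟩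
    p * ((1# - q * 1#) * (1# - q * U)) * ((1# - k * (q * (x * x))) * (sgn n * qTri (suc n)))
      + (1# - q * x) * (p * ((1# - q * 1#) * (1# - k * U)) * φ (suc n))
      ≈⟨ solve 6 (λ p x q k s Q → let U = q :* (x :* x) in
           p :* ((1' :- q :* 1') :* (1' :- q :* U)) :* ((1' :- k :* (q :* (x :* x))) :* (s :* Q))
             :+ (1' :- q :* x) :* (p :* ((1' :- q :* 1') :* (1' :- k :* U)) :* ((:- 1' :* s) :* (Q :* (1' :+ q :* x))))
           := 0')
         refl p x q k (sgn n) (qTri (suc n)) ⟩
    0# ∎
    where
    b = suc (n ℕ.+ n)
    x = q ^ n
    U = q * (x * x)
    p = ratio⁺ 0 * ratio⁺ b
    ratio[0]≈ : ratio (n ∸ n) ≈ ratio⁺ 0 * (1# - q * 1#)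
    ratio[0]≈ = trans (ratio-≡ (ℕ.n∸n≡0 n)) (ratio≈ratio⁺*[1-qx] 0 refl)
    ratio[b]≈ : ratio b ≈ ratio⁺ b * (1# - q * U)
    ratio[b]≈ = ratio≈ratio⁺*[1-qx] b (*-congˡ (^-homo-* q n n))
    ratio[1+b]≈ : ratio (suc b) ≈ ratio⁺ b * (1# - k * U)
    ratio[1+b]≈ = ratio[1+a]≈ratio⁺*[1-kx] b (*-congˡ (^-homo-* q n n))

  bailey-φ-recurrence : ∀ n → (1# - q ^ suc n) * bailey φ (suc n) + κ n * bailey φ n ≈ 0#
  bailey-φ-recurrence n = begin
    a * (S + L) + κ n * bailey φ n
      ≈⟨ solve 4 (λ a S L b → a :* (S :+ L) :+ b := (a :* S :+ b) :+ a :* L) refl a S L (κ n * bailey φ n) ⟩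
    (a * S + κ n * bailey φ n) + a * L
      ≈⟨ +-congʳ (sumTo-linear n a (κ n) (λ j → W (suc n) j * φ j) (λ j → W n j * φ j)) ⟨
    sumTo n (λ j → a * (W (suc n) j * φ j) + κ n * (W n j * φ j)) + a * L
      ≈⟨ +-congʳ (sumTo-telescope n _ (G n) refl (λ j → ≤-offset-elim
           (λ n j → (1# - q ^ suc n) * (W (suc n) j * φ j) + κ n * (W n j * φ j) ≈ G n (suc j) - G n j)
           G-telescopes)) ⟩
    G n (suc n) + a * L
      ≈⟨ G-boundary n ⟩
    0# ∎
    where
    a = 1# - q ^ suc n
    S = sumTo n (λ j → W (suc n) j * φ j)
    L = W (suc n) (suc n) * φ (suc n)

  ψ-recurrence : ∀ n → (1# - q ^ suc n) * ψ (suc n) ≈ - (κ n * ψ n)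
  ψ-recurrence n = begin
    (1# - q * x) * ψ (suc n)
      ≈⟨ solve 8 (λ x q k s kⁿ Q P D⁺ →
           (1' :- q :* x) :* ((:- 1' :* s) :* ((k :* kⁿ) :* ((Q :* x) :* ((P :* (1' :- k :* x)) :* D⁺))))
           := :- ((k :* x :* (1' :- k :* x)) :* (s :* (kⁿ :* (Q :* (P :* (D⁺ :* (1' :- q :* x))))))))
         refl x q k (sgn n) (k ^ n) (qTri n) (qPoch k q n) (qPoch q q (suc n) ⁻¹) ⟩
    - (κ n * (sgn n * (k ^ n * (qTri n * (qPoch k q n * (qPoch q q (suc n) ⁻¹ * (1# - q * x)))))))
      ≈⟨ -‿cong (*-congˡ (*-congˡ (*-congˡ (*-congˡ (*-congˡ (qPoch-q⁻¹≈ n)))))) ⟨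
    - (κ n * ψ n) ∎
    where
    x = q ^ n

  bailey-φ≈ψ : ∀ n → bailey φ n ≈ ψ n
  bailey-φ≈ψ zero = trans (trans (*-identityʳ _) W[0,0]≈1)
    (sym (trans (*-identityˡ _) (trans (*-identityˡ _) (trans (*-identityˡ _) ratio[0]≈1))))
  bailey-φ≈ψ (suc n) = *-cancelˡ (x*y≉0⇒y≉0 (qPoch-q≉0 (suc n))) (begin
    (1# - q ^ suc n) * bailey φ (suc n) ≈⟨ inverseˡ-unique _ _ (bailey-φ-recurrence n) ⟩
    - (κ n * bailey φ n)               ≈⟨ -‿cong (*-congˡ (bailey-φ≈ψ n)) ⟩
    - (κ n * ψ n)                      ≈⟨ ψ-recurrence n ⟨
    (1# - q ^ suc n) * ψ (suc n)       ∎)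

  P : Carrier → Carrier
  P x = 1# - x + k * (x * x)

  E : ℕ → ℕ → Carrier
  E n zero    = 0#
  E n (suc j) = W n j * ((1# - k * q ^ (j ℕ.+ n)) * (1# - q ^ (n ∸ j))) * (sgn (suc j) * qTri (suc j))

  E-telescopes : ∀ j d → let n = j ℕ.+ d in
    (k * q ^ n) * (W n j * α j) + - P (q ^ n) * (W n j * φ j) ≈ E n (suc j) - E n j
  E-telescopes zero d =
    solve 3 (λ w x k → (k :* x) :* (w :* 1') :+ :- (1' :- x :+ k :* (x :* x)) :* (w :* 1')
                       := w :* ((1' :- k :* x) :* (1' :- x)) :* ((:- 1' :* 1') :* (1' :* 1')) :- 0')
      refl (W d 0) (q ^ d) k
  E-telescopes (suc i) d = begin
    (k * q ^ n) * (W n (suc i) * α (suc i)) + - P (q ^ n) * (W n (suc i) * φ (suc i))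
      ≈⟨ +-congʳ (solve 4 (λ k x w a → (k :* x) :* (w :* a) := k :* w :* (x :* a))
                          refl k (q ^ n) (W n (suc i)) (α (suc i))) ⟩
    k * W n (suc i) * (q ^ n * α (suc i)) + - P (q ^ n) * (W n (suc i) * φ (suc i))
      ≈⟨ +-cong (*-cong (*-congˡ W[n,1+i]≈) (q^[j+d]*α≈ i d)) (*-cong (-‿cong P[q^n]≈) (*-congʳ W[n,1+i]≈)) ⟩
    k * w * (sgn (suc i) * (qTri (suc i) * (z * (1# + y * (y * y))))) + - P X * (w * φ (suc i))
      ≈⟨ solve 7 (λ p z r q k s Q →
           let X = q :* (r :* z) ; U = r :* X ; y = q :* r ; w = p :* ((1' :- q :* z) :* (1' :- k :* U)) in
           k :* w :* ((:- 1' :* s) :* (Q :* (z :* (1' :+ y :* (y :* y)))))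
             :+ :- (1' :- X :+ k :* (X :* X)) :* (w :* ((:- 1' :* s) :* (Q :* (1' :+ y))))
           := w :* ((1' :- k :* (q :* U)) :* (1' :- z)) :* ((:- 1' :* (:- 1' :* s)) :* (Q :* y))
                :- p :* ((1' :- k :* z) :* (1' :- q :* U)) :* ((1' :- k :* U) :* (1' :- q :* z)) :* ((:- 1' :* s) :* Q))
         refl p z r q k (sgn i) (qTri (suc i)) ⟩
    w * ((1# - k * (q * U)) * (1# - z)) * (sgn (suc (suc i)) * qTri (suc (suc i)))
      - p * ((1# - k * z) * (1# - q * U)) * ((1# - k * U) * (1# - q * z)) * (sgn (suc i) * qTri (suc i))
      ≈⟨ +-cong (*-congʳ (*-cong W[n,1+i]≈ (*-cong (1-u*x-cong k (*-congˡ q^b≈U)) (1-q^-≡ (ℕ.m+n∸m≡n i d)))))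
                (-‿cong (*-congʳ (*-cong W[n,i]≈ (*-cong (1-u*x-cong k q^b≈U) (1-q^-≡ ([1+j+d]∸j≡1+d i d)))))) ⟨
    E n (suc (suc i)) - E n (suc i) ∎
    where
    n = suc i ℕ.+ d
    b = i ℕ.+ n
    r = q ^ i
    y = q * r
    z = q ^ d
    X = q * (r * z)
    U = r * X
    p = ratio⁺ d * ratio⁺ b
    w = p * ((1# - q * z) * (1# - k * U))
    q^n≈X : q ^ n ≈ X
    q^n≈X = *-congˡ (^-homo-* q i d)
    q^b≈U : q ^ b ≈ U
    q^b≈U = trans (^-homo-* q i n) (*-congˡ q^n≈X)
    P[q^n]≈ : P (q ^ n) ≈ P X
    P[q^n]≈ = +-cong (+-congˡ (-‿cong q^n≈X)) (*-congˡ (*-cong q^n≈X q^n≈X))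
    1-q^-≡ : ∀ {a b} → a ≡ b → 1# - q ^ a ≈ 1# - q ^ b
    1-q^-≡ a≡b = +-congˡ (-‿cong (reflexive (≡.cong (q ^_) a≡b)))
    W[n,1+i]≈ : W n (suc i) ≈ w
    W[n,1+i]≈ = *-cong-interchange (ratio[j+d∸j]≈ i d) (ratio[1+a]≈ratio⁺*[1-kx] b q^b≈U)
    W[n,i]≈ : W n i ≈ p * ((1# - k * z) * (1# - q * U))
    W[n,i]≈ = *-cong-interchange (ratio[1+j+d∸j]≈ i d) (ratio≈ratio⁺*[1-qx] b q^b≈U)

  E[n,1+n]≈0 : ∀ n → E n (suc n) ≈ 0#
  E[n,1+n]≈0 n = begin
    W n n * (f * (1# - q ^ (n ∸ n))) * g  ≡⟨ ≡.cong (λ m → W n n * (f * (1# - q ^ m)) * g) (ℕ.n∸n≡0 n) ⟩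
    W n n * (f * (1# - 1#)) * g           ≈⟨ solve 3 (λ w f g → w :* (f :* (1' :- 1')) :* g := 0') refl (W n n) f g ⟩
    0#                                    ∎
    where
    f = 1# - k * q ^ (n ℕ.+ n)
    g = sgn (suc n) * qTri (suc n)

  k*q^n*bailey-α≈P*bailey-φ : ∀ n → (k * q ^ n) * bailey α n ≈ P (q ^ n) * bailey φ n
  k*q^n*bailey-α≈P*bailey-φ n = x∙y⁻¹≈ε⇒x≈y _ _ (begin
    (k * q ^ n) * bailey α n - P (q ^ n) * bailey φ n
      ≈⟨ +-congˡ (-‿distribˡ-* (P (q ^ n)) (bailey φ n)) ⟩
    (k * q ^ n) * bailey α n + - P (q ^ n) * bailey φ n
      ≈⟨ sumTo-linear n (k * q ^ n) (- P (q ^ n)) (λ j → W n j * α j) (λ j → W n j * φ j) ⟨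
    sumTo n (λ j → (k * q ^ n) * (W n j * α j) + - P (q ^ n) * (W n j * φ j))
      ≈⟨ sumTo-telescope n _ (E n) refl (λ j → ≤-offset-elim
           (λ n j → (k * q ^ n) * (W n j * α j) + - P (q ^ n) * (W n j * φ j) ≈ E n (suc j) - E n j)
           E-telescopes) ⟩
    E n (suc n)
      ≈⟨ E[n,1+n]≈0 n ⟩
    0# ∎)

  k*q^n*β≈P*ψ : ∀ m → (k * q ^ suc m) * beta16 k q (suc m) ≈ P (q ^ suc m) * ψ (suc m)
  k*q^n*β≈P*ψ m = begin
    (k * X) * (((((s * ((1# - X) + k * q ^ (2 ℕ.* N))) * qPoch k q N) * k ^ m) * h) * D)
      ≈⟨ *-congˡ (*-congʳ (*-congʳ (*-congʳ (*-congʳ (*-congˡ (+-congˡ (*-congˡ q^2N≈X*X))))))) ⟩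
    (k * X) * (((((s * ((1# - X) + k * (X * X))) * qPoch k q N) * k ^ m) * h) * D)
      ≈⟨ solve 7 (λ X k s Pk kᵐ h D →
           (k :* X) :* (((((s :* ((1' :- X) :+ k :* (X :* X))) :* Pk) :* kᵐ) :* h) :* D)
           := (1' :- X :+ k :* (X :* X)) :* (s :* ((k :* kᵐ) :* ((X :* h) :* (Pk :* D)))))
         refl X k s (qPoch k q N) (k ^ m) h D ⟩
    P X * (s * ((k * k ^ m) * ((X * h) * (qPoch k q N * D))))
      ≈⟨ *-congˡ (*-congˡ (*-congˡ (*-congʳ (q^j*qHalfMinus≈qTri N)))) ⟩
    P X * ψ N ∎
    where
    N = suc m
    X = q ^ N
    s = sgn N
    h = qHalfMinus q N
    D = qPoch q q N ⁻¹
    q^2N≈X*X : q ^ (2 ℕ.* N) ≈ X * X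
    q^2N≈X*X = trans (^-homo-* q N (N ℕ.+ 0)) (*-congˡ (reflexive (≡.cong (q ^_) (ℕ.+-identityʳ N))))

  β≈bailey-α : ∀ n → beta16 k q n ≈ bailey α n
  β≈bailey-α zero    = sym (trans (*-identityʳ _) W[0,0]≈1)
  β≈bailey-α (suc m) = *-cancelˡ (x≉0∧y≉0⇒x*y≉0 k≉0 (x≉0⇒x^n≉0 (suc m) q≉0)) (begin
    (k * q ^ suc m) * beta16 k q (suc m)   ≈⟨ k*q^n*β≈P*ψ m ⟩
    P (q ^ suc m) * ψ (suc m)              ≈⟨ *-congˡ (bailey-φ≈ψ (suc m)) ⟨
    P (q ^ suc m) * bailey φ (suc m)       ≈⟨ k*q^n*bailey-α≈P*bailey-φ (suc m) ⟨
    (k * q ^ suc m) * bailey α (suc m)     ∎)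

  wpCoefficient≈W : ∀ n j →
    (qPoch (k ÷ 1#) q (n ∸ j) * qPoch k q (n ℕ.+ j)) ÷ (qPoch q q (n ∸ j) * qPoch (1# * q) q (n ℕ.+ j)) ≈ W n j
  wpCoefficient≈W n j = begin
    (qPoch (k ÷ 1#) q a * qPoch k q b) * (qPoch q q a * qPoch (1# * q) q b) ⁻¹
      ≈⟨ *-cong (*-congʳ (qPoch-congˡ q a k÷1≈k)) (sym (⁻¹-cong (x≉0∧y≉0⇒x*y≉0 (qPoch-q≉0 a) (qPoch-q≉0 b))
                                                             (*-congˡ (sym (qPoch-congˡ q b (*-identityˡ q)))))) ⟩
    (qPoch k q a * qPoch k q b) * (qPoch q q a * qPoch q q b) ⁻¹
      ≈⟨ *-congˡ (⁻¹-distrib-* (qPoch-q≉0 a) (qPoch-q≉0 b)) ⟩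
    (qPoch k q a * qPoch k q b) * (qPoch q q a ⁻¹ * qPoch q q b ⁻¹)
      ≈⟨ solve 4 (λ u v x y → (u :* v) :* (x :* y) := (u :* x) :* (v :* y)) refl _ _ _ _ ⟩
    ratio a * ratio b
      ≡⟨ ≡.cong (λ m → ratio a * ratio m) (ℕ.+-comm n j) ⟩
    W n j ∎
    where
    a = n ∸ j
    b = n ℕ.+ j
    k÷1≈k : k ÷ 1# ≈ k
    k÷1≈k = trans (*-congˡ 1⁻¹≈1) (*-identityʳ k)

mainTheorem16 : ∀ {c ℓ} (F : Field c ℓ) (k q : Field.Carrier F) →
    ¬ (Field._≈_ F q (Field.0# F)) →
    ¬ (Field._≈_ F k (Field.0# F)) →
    (∀ (m : ℕ) → ¬ (Field._≈_ F (FieldOps.qPoch F q q m) (Field.0# F))) →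
    FieldOps.IsWPBaileyPair F q (Field.1# F) k (FieldOps.alpha16 F q) (FieldOps.beta16 F k q)
mainTheorem16 F k q q≉0 k≉0 qPoch-q≉0 = refl , λ n →
  trans (β≈bailey-α n) (sym (sumTo-cong n (λ j _ → *-congʳ (wpCoefficient≈W n j))))
  where
  open Field F using (refl; trans; sym; *-congʳ)
  open FieldProperties F using (sumTo-cong)
  open WPBaileyPair16 F k q q≉0 k≉0 qPoch-q≉0 using (β≈bailey-α; wpCoefficient≈W)
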